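{- Let $\Delta$ be a pure simplicial complex. Then: (i) every shelling of $\Delta$ is a pre-shelling; (ii) if $\Omega$ is a pre-shelling of $\Delta$ and $\Lambda$ is a partial order on the facets with $\Omega\subseteq\Lambda$, then $\Lambda$ is a pre-shelling of $\Delta$ and $r_\Lambda(F)=r_\Omega(F)$ for every facet $F$; in particular the set of pre-shellings of $\Delta$ is an upper ideal in the poset of all partial orders on the set of facets of $\Delta$ (ordered by inclusion); (iii) every linear extension of a pre-shelling of $\Delta$ is a shelling of $\Delta$, with the same restriction function.
   Context: A simplicial complex is a family of subsets of a vertex set containing all singletons and closed under subsets; facets are maximal faces; it is pure if all facets have equal cardinality. For a partial order $\Omega$ on the facets, $r_\Omega(F)=\{x\in F:\exists\text{ facet }E<_\Omega F\text{ with }E\cap F=F\setminus\{x\}\}$. $\Omega$ is a pre-shelling if for all facets $F,G$ with $F\not\ge_\Omega G$ there exist $x\in G$ and a facet $E<_\Omega G$ with $F\cap G\subseteq E\cap G=G\setminus\{x\}$ (equivalently: $r_\Omega(F)\subseteq G$ and $r_\Omega(G)\subseteq F$ imply $F=G$). A shelling is a linear (total) order $\Omega$ on the facets such that whenever $F<_\Omega G$ there exist $x\in G$ and $E<_\Omega G$ with $F\cap G\subseteq E\cap G=G\setminus\{x\}$. Partial orders on the same set are ordered by inclusion: $\Omega\subseteq\Lambda$ if $x<_\Omega y$ implies $x<_\Lambda y$. -}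

module Defs where

open import Data.Nat using (ℕ)
open import Data.Fin using (Fin)
open import Data.Fin.Subset using (Subset; _∈_; _⊆_; _∩_; _-_; ⁅_⁆; ∣_∣)
open import Data.Product using (Σ; ∃; _×_)
open import Data.Sum using (_⊎_)
open import Relation.Binary.PropositionalEquality using (_≡_; _≢_)
open import Relation.Nullary using (¬_)
open import Function.Bundles using (_⇔_)

record SimplicialComplex (n : ℕ) : Set₁ where
  field
    IsFace     : Subset n → Set
    singletons : ∀ (v : Fin n) → IsFace ⁅ v ⁆
    downClosed : ∀ {F G : Subset n} → IsFace G → F ⊆ G → IsFace F

module _ {n : ℕ} (Δ : SimplicialComplex n) where
  open SimplicialComplex Δ

  IsFacet : Subset n → Set
  IsFacet F = IsFace F × (∀ G → IsFace G → F ⊆ G → G ≡ F)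

  IsPure : Set
  IsPure = ∀ F G → IsFacet F → IsFacet G → ∣ F ∣ ≡ ∣ G ∣

  record PartialOrderOnFacets : Set₁ where
    field
      _≤_     : Subset n → Subset n → Set
      refl    : ∀ F → IsFacet F → F ≤ F
      antisym : ∀ F G → IsFacet F → IsFacet G → F ≤ G → G ≤ F → F ≡ G
      trans   : ∀ F G H → IsFacet F → IsFacet G → IsFacet H →
                F ≤ G → G ≤ H → F ≤ H

  module _ (Ω : PartialOrderOnFacets) where
    open PartialOrderOnFacets Ω

    _<_ : Subset n → Subset n → Set
    F < G = F ≤ G × F ≢ G

    IsLinear : Set
    IsLinear = ∀ F G → IsFacet F → IsFacet G → (F ≤ G) ⊎ (G ≤ F)

    r : Subset n → Fin n → Set
    r F x = x ∈ F × Σ (Subset n) λ E → IsFacet E × E < F × (E ∩ F ≡ F - x)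

    IsPreShelling : Set
    IsPreShelling = ∀ F G → IsFacet F → IsFacet G → ¬ (G ≤ F) →
      Σ (Fin n) λ x → x ∈ G × Σ (Subset n) λ E →
        IsFacet E × E < G × (F ∩ G) ⊆ (E ∩ G) × (E ∩ G ≡ G - x)

    IsShelling : Set
    IsShelling = IsLinear × (∀ F G → IsFacet F → IsFacet G → F < G →
      Σ (Fin n) λ x → x ∈ G × Σ (Subset n) λ E →
        IsFacet E × E < G × (F ∩ G) ⊆ (E ∩ G) × (E ∩ G ≡ G - x))

  _⊑_ : PartialOrderOnFacets → PartialOrderOnFacets → Set
  Ω ⊑ Λ = ∀ F G → IsFacet F → IsFacet G → _<_ Ω F G → _<_ Λ F G

  SameRestriction : PartialOrderOnFacets → PartialOrderOnFacets → Set
  SameRestriction Ω Λ = ∀ F → IsFacet F → ∀ x → r Λ F x ⇔ r Ω F x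

{-# OPTIONS --safe #-}
-- Enlarging a partial order only adds facets strictly below a given facet and
-- only removes pairs with F ≱ G, so the pre-shelling condition survives.  The
-- restriction sets do not change: if E <_Λ F witnesses x ∈ r_Λ(F), then F ≰_Ω E,
-- and the pre-shelling condition for Ω gives E' <_Ω F with
-- F ∖ x = E ∩ F ⊆ E' ∩ F = F ∖ y, whence y = x.  For a linear order, F ≱ G
-- means F < G, so linear pre-shellings are exactly shellings.
module Submission where

open import Defs
open import Data.Nat using (ℕ)
open import Data.Bool.Properties using () renaming (_≟_ to _≟ᵇ_)
open import Data.Empty using (⊥-elim)
open import Data.Fin using (Fin) renaming (_≟_ to _≟ᶠ_)
open import Data.Fin.Subset using (Subset; _∈_; _∉_; _⊆_; _─_; _-_; ⁅_⁆; inside)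
open import Data.Fin.Subset.Properties using (x∈⁅x⁆; x∈p∧x≢y⇒x∈p-y)
open import Data.Product using (_×_; _,_; proj₁)
open import Data.Sum using (inj₁; inj₂)
open import Data.Vec.Base using (_∷_; here; there)
open import Data.Vec.Properties using (≡-dec)
open import Function using (_∘_)
open import Function.Bundles using (mk⇔)
open import Relation.Binary.Definitions using (DecidableEquality)
open import Relation.Binary.PropositionalEquality using (_≡_; refl; sym; subst₂)
open import Relation.Nullary using (¬_; yes; no)

_≟ˢ_ : ∀ {n} → DecidableEquality (Subset n)
_≟ˢ_ = ≡-dec _≟ᵇ_

x∉p─q : ∀ {n} {x : Fin n} (p q : Subset n) → x ∈ q → x ∉ p ─ q
x∉p─q (_ ∷ p) (inside ∷ q) here        ()
x∉p─q (_ ∷ p) (_ ∷ q)      (there x∈q) (there x∈p─q) = x∉p─q p q x∈q x∈p─q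

x∉p-x : ∀ {n} (p : Subset n) (x : Fin n) → x ∉ p - x
x∉p-x p x = x∉p─q p ⁅ x ⁆ (x∈⁅x⁆ x)

p-x⊆p-y⇒x≡y : ∀ {n} {p : Subset n} {x y : Fin n} → y ∈ p → p - x ⊆ p - y → x ≡ y
p-x⊆p-y⇒x≡y {p = p} {x} {y} y∈p p-x⊆p-y with y ≟ᶠ x
... | yes y≡x = sym y≡x
... | no  y≢x = ⊥-elim (x∉p-x p y (p-x⊆p-y (x∈p∧x≢y⇒x∈p-y y∈p y≢x)))

module _ {n : ℕ} {Δ : SimplicialComplex n} where

  module _ (Ω : PartialOrderOnFacets Δ) where
    open PartialOrderOnFacets Ω

    <⇒≱ : ∀ {F G} → IsFacet Δ F → IsFacet Δ G → _<_ Δ Ω F G → ¬ (G ≤ F)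
    <⇒≱ {F} {G} fF fG (F≤G , F≢G) G≤F = F≢G (antisym F G fF fG F≤G G≤F)

    ≱⇒< : IsLinear Δ Ω → ∀ {F G} → IsFacet Δ F → IsFacet Δ G → ¬ (G ≤ F) → _<_ Δ Ω F G
    ≱⇒< linear {F} {G} fF fG G≰F with linear F G fF fG
    ... | inj₁ F≤G = F≤G , λ { refl → G≰F F≤G }
    ... | inj₂ G≤F = ⊥-elim (G≰F G≤F)

    shelling⇒preShelling : IsShelling Δ Ω → IsPreShelling Δ Ω
    shelling⇒preShelling (linear , shell) F G fF fG G≰F =
      shell F G fF fG (≱⇒< linear fF fG G≰F)

    preShelling∧linear⇒shelling : IsPreShelling Δ Ω → IsLinear Δ Ω → IsShelling Δ Ω
    preShelling∧linear⇒shelling pre linear =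
      linear , λ F G fF fG F<G → pre F G fF fG (<⇒≱ fF fG F<G)

  module _ (Ω Λ : PartialOrderOnFacets Δ) (Ω⊑Λ : _⊑_ Δ Ω Λ) where
    private
      module Ω = PartialOrderOnFacets Ω
      module Λ = PartialOrderOnFacets Λ

    ⊑⇒≤-mono : ∀ {F G} → IsFacet Δ F → IsFacet Δ G → F Ω.≤ G → F Λ.≤ G
    ⊑⇒≤-mono {F} {G} fF fG F≤G with F ≟ˢ G
    ... | yes refl = Λ.refl F fF
    ... | no  F≢G  = proj₁ (Ω⊑Λ F G fF fG (F≤G , F≢G))

    preShelling-mono : IsPreShelling Δ Ω → IsPreShelling Δ Λ
    preShelling-mono pre F G fF fG G≰F with pre F G fF fG (G≰F ∘ ⊑⇒≤-mono fG fF)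
    ... | x , x∈G , E , fE , E<G , F∩G⊆E∩G , E∩G≡G-x =
      x , x∈G , E , fE , Ω⊑Λ E G fE fG E<G , F∩G⊆E∩G , E∩G≡G-x

    restriction-invariant : IsPreShelling Δ Ω → SameRestriction Δ Ω Λ
    restriction-invariant pre F fF x = mk⇔ Λ⇒Ω Ω⇒Λ
      where
      Ω⇒Λ : r Δ Ω F x → r Δ Λ F x
      Ω⇒Λ (x∈F , E , fE , E<F , E∩F≡F-x) = x∈F , E , fE , Ω⊑Λ E F fE fF E<F , E∩F≡F-x

      Λ⇒Ω : r Δ Λ F x → r Δ Ω F x
      Λ⇒Ω (x∈F , E , fE , E<F , E∩F≡F-x)
        with pre E F fE fF (<⇒≱ Λ fE fF E<F ∘ ⊑⇒≤-mono fF fE)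
      ... | y , y∈F , E′ , fE′ , E′<F , E∩F⊆E′∩F , E′∩F≡F-y
        with p-x⊆p-y⇒x≡y y∈F (subst₂ _⊆_ E∩F≡F-x E′∩F≡F-y E∩F⊆E′∩F)
      ... | refl = x∈F , E′ , fE′ , E′<F , E′∩F≡F-y

corollary3p2 : ∀ {n : ℕ} (Δ : SimplicialComplex n) → IsPure Δ →
      ((Ω : PartialOrderOnFacets Δ) → IsShelling Δ Ω → IsPreShelling Δ Ω)
    × ((Ω Λ : PartialOrderOnFacets Δ) → IsPreShelling Δ Ω → _⊑_ Δ Ω Λ →
        IsPreShelling Δ Λ × SameRestriction Δ Ω Λ)
    × ((Ω Λ : PartialOrderOnFacets Δ) → IsPreShelling Δ Ω → _⊑_ Δ Ω Λ →
        IsLinear Δ Λ → IsShelling Δ Λ × SameRestriction Δ Ω Λ)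
corollary3p2 Δ _ =
    shelling⇒preShelling
  , (λ Ω Λ pre Ω⊑Λ → preShelling-mono Ω Λ Ω⊑Λ pre , restriction-invariant Ω Λ Ω⊑Λ pre)
  , (λ Ω Λ pre Ω⊑Λ linear →
        preShelling∧linear⇒shelling Λ (preShelling-mono Ω Λ Ω⊑Λ pre) linear
      , restriction-invariant Ω Λ Ω⊑Λ pre)
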